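{- Let $G$ be a $2$-connected maximal nontraceable graph, and let $v_1,v_2\in V(G)$ with $d(v_1)=d(v_2)=2$ such that $v_1$ and $v_2$ have exactly one common neighbour $x$. Then $d(x)\ge 5$.
   Context: All graphs are simple and finite. A graph is traceable if it has a hamiltonian path (a path containing all its vertices). A graph $G$ is maximal nontraceable (MNT) if $G$ is not traceable but $G+e$ is traceable for every edge $e$ of the complement $\overline{G}$. $d(v)$ denotes the degree of $v$. -}

module Defs where

open import Data.Nat using (ℕ)
open import Data.Fin using (Fin)
open import Data.Bool using (Bool; true; false; if_then_else_)
open import Data.List using (List; allFin; map)
open import Data.Nat.ListAction using (sum)
open import Data.List.Membership.Propositional using (_∈_)
open import Data.List.Relation.Unary.Unique.Propositional using (Unique)
open import Data.List.Relation.Unary.Linked using (Linked)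
open import Data.Product using (Σ; _×_)
open import Data.Sum using (_⊎_)
open import Data.Unit using (⊤)
open import Relation.Binary.PropositionalEquality using (_≡_; _≢_)
open import Relation.Nullary using (¬_)

record Graph (n : ℕ) : Set where
  field
    adj     : Fin n → Fin n → Bool
    sym     : ∀ u v → adj u v ≡ adj v u
    irrefl  : ∀ v → adj v v ≡ false
open Graph public

Adj : ∀ {n} → Graph n → Fin n → Fin n → Set
Adj G u v = adj G u v ≡ true

deg : ∀ {n} → Graph n → Fin n → ℕ
deg {n} G v = sum (map (λ w → if adj G v w then 1 else 0) (allFin n))

IsHamPath : ∀ {n} → (Fin n → Fin n → Set) → List (Fin n) → Set
IsHamPath R p = Unique p × (∀ v → v ∈ p) × Linked R p

TraceableRel : ∀ {n} → (Fin n → Fin n → Set) → Set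
TraceableRel R = Σ _ (IsHamPath R)

Traceable : ∀ {n} → Graph n → Set
Traceable G = TraceableRel (Adj G)

AdjPlus : ∀ {n} → Graph n → Fin n → Fin n → Fin n → Fin n → Set
AdjPlus G u v x y = Adj G x y ⊎ ((x ≡ u × y ≡ v) ⊎ (x ≡ v × y ≡ u))

MaximalNontraceable : ∀ {n} → Graph n → Set
MaximalNontraceable G =
  ¬ Traceable G ×
  (∀ u v → u ≢ v → adj G u v ≡ false → TraceableRel (AdjPlus G u v))

data WalkIn {n} (G : Graph n) (P : Fin n → Set) : Fin n → Fin n → Set where
  here : ∀ {x} → P x → WalkIn G P x x
  step : ∀ {x z y} → P x → Adj G x z → WalkIn G P z y → WalkIn G P x y

Connected : ∀ {n} → Graph n → Set
Connected G = ∀ x y → WalkIn G (λ _ → ⊤) x y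

TwoConnected : ∀ {n} → Graph n → Set
TwoConnected {n} G =
  3 Data.Nat.≤ n × Connected G ×
  (∀ w x y → x ≢ w → y ≢ w → WalkIn G (λ z → z ≢ w) x y)

module Submission where

-- Suppose d(x) ≤ 4, and let a₁, a₂ be the other neighbours of v₁, v₂. In a maximal
-- nontraceable graph the two neighbours of a vertex of degree 2 are adjacent, so
-- N(x) = {v₁, v₂, a₁, a₂}. Moreover v₁v₂ ∉ E: otherwise {v₁, v₂} would be cut off by x,
-- so by 2-connectivity V = {v₁, v₂, x} and v₁v₂x would be a hamiltonian path.
-- A hamiltonian path of G + v₁v₂ must use the new edge; deleting it leaves two disjoint
-- paths of G, from v₁ and from v₂, covering V. Say x is on the path from v₂. Its
-- neighbours along that path can only be a₁ and a₂. If a₁ is one of them, the path from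
-- v₁ is just v₁ (its next vertex would be x or a₁), and v₁ is inserted between x and a₁.
-- Otherwise the path from v₂ is v₂ x a₂ … or ends in x; rearranged to start at x (as
-- x v₂ a₂ … or reversed), it is joined to the path from v₁ through the edge v₁x.

open import Defs hiding (sym)
open import Data.Bool using (true; false; if_then_else_)
open import Data.Bool.Properties using (¬-not) renaming (_≟_ to _≟ᵇ_)
open import Data.Empty using (⊥; ⊥-elim)
open import Data.Fin using (Fin)
open import Data.Fin.Properties using (_≟_)
open import Data.List
  using (List; []; _∷_; _++_; [_]; length; reverse; _ʳ++_; filter; allFin; map)
open import Data.List.Properties using (++-assoc; reverse-++; length-++-sucʳ)
open import Data.List.Membership.Propositional using (_∈_; _∉_)
open import Data.List.Membership.Propositional.Properties
  using (∈-∃++; ∈-++⁺ˡ; ∈-++⁺ʳ; ∈-++⁻; ∈-allFin; ∈-filter⁺; ∈-filter⁻)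
import Data.List.Membership.DecPropositional as DecMembership
open import Data.List.Relation.Binary.Disjoint.Propositional using (Disjoint)
open import Data.List.Relation.Binary.Permutation.Propositional
  using (_↭_; refl; swap; ↭-sym; ↭-trans; ↭⇒↭ₛ)
open import Data.List.Relation.Binary.Permutation.Propositional.Properties
  using (∈-resp-↭; shift; ++⁺ˡ; ++⁺ʳ; ++-comm; ↭-reverse; ++↭ʳ++; ∷↭∷ʳ)
open import Data.List.Relation.Binary.Subset.Propositional using (_⊆_)
open import Data.List.Relation.Unary.All as All using ([]; _∷_)
open import Data.List.Relation.Unary.All.Properties using (¬Any⇒All¬)
open import Data.List.Relation.Unary.AllPairs using ([]; _∷_)
open import Data.List.Relation.Unary.Any using (here; there)
open import Data.List.Relation.Unary.Linked as Linked using (Linked; []; [-]; _∷_)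
open import Data.List.Relation.Unary.Unique.Propositional using (Unique)
open import Data.List.Relation.Unary.Unique.Propositional.Properties
  using (allFin⁺; filter⁺; Unique[x∷xs]⇒x∉xs)
open import Data.Nat using (ℕ; suc; _≤_; _≥_; s≤s; z≤n; _≤?_)
open import Data.Nat.Properties using (≤-trans; ≰⇒>; 1+n≰n; ≤-pred)
open import Data.Nat.ListAction using (sum)
open import Data.Product using (Σ-syntax; _×_; _,_; proj₁; proj₂; ∃₂)
open import Data.Sum using (_⊎_; inj₁; inj₂)
open import Function using (_∘_; case_of_)
open import Level using (Level; _⊔_)
open import Relation.Binary.Core using (Rel)
open import Relation.Binary.Definitions using (Symmetric)
open import Relation.Binary.PropositionalEquality
  using (_≡_; _≢_; refl; sym; trans; cong; subst; ≢-sym; setoid)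
open import Relation.Nullary using (¬_; yes; no)
import Data.List.Relation.Binary.Permutation.Setoid.Properties as ↭ₛ

module _ {a : Level} {A : Set a} where

  Unique-resp-↭ : ∀ {xs ys : List A} → xs ↭ ys → Unique xs → Unique ys
  Unique-resp-↭ p = ↭ₛ.Unique-resp-↭ (setoid A) (↭⇒↭ₛ p)

  Unique-++⁻ʳ : ∀ (xs : List A) {ys} → Unique (xs ++ ys) → Unique ys
  Unique-++⁻ʳ []       u       = u
  Unique-++⁻ʳ (x ∷ xs) (_ ∷ u) = Unique-++⁻ʳ xs u

  Unique-++⇒Disjoint : ∀ (xs : List A) {ys} → Unique (xs ++ ys) → Disjoint xs ys
  Unique-++⇒Disjoint (x ∷ xs) (x∉ ∷ _) (here refl , v∈ys) =
    All.lookup x∉ (∈-++⁺ʳ xs v∈ys) refl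
  Unique-++⇒Disjoint (x ∷ xs) (_ ∷ u) (there v∈xs , v∈ys) =
    Unique-++⇒Disjoint xs u (v∈xs , v∈ys)

  length≡2⇒pair : ∀ {x} {xs : List A} → length xs ≡ 2 → Unique xs → x ∈ xs →
                    Σ[ a ∈ A ] a ≢ x × a ∈ xs × xs ⊆ x ∷ a ∷ []
  length≡2⇒pair {xs = _ ∷ y ∷ []} refl ((x≢y ∷ []) ∷ _) (here refl) =
    y , ≢-sym x≢y , there (here refl) , λ where
      (here refl)         → here refl
      (there (here refl)) → there (here refl)
  length≡2⇒pair {xs = y ∷ _ ∷ []} refl ((y≢x ∷ []) ∷ _) (there (here refl)) =
    y , y≢x , here refl , λ where
      (here refl)         → there (here refl)
      (there (here refl)) → here refl

  length-mono-⊆ : ∀ {xs ys : List A} → Unique xs → xs ⊆ ys → length xs ≤ length ys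
  length-mono-⊆ {[]}     _        _     = z≤n
  length-mono-⊆ {x ∷ xs} (x∉ ∷ u) xs⊆ys with ∈-∃++ (xs⊆ys (here refl))
  ... | ys₁ , ys₂ , refl = subst (suc (length xs) ≤_) (sym (length-++-sucʳ ys₁ x ys₂))
                             (s≤s (length-mono-⊆ u xs⊆ys₁ys₂))
    where
    xs⊆ys₁ys₂ : xs ⊆ ys₁ ++ ys₂
    xs⊆ys₁ys₂ v∈xs with ∈-++⁻ ys₁ (xs⊆ys (there v∈xs))
    ... | inj₁ v∈ys₁           = ∈-++⁺ˡ v∈ys₁
    ... | inj₂ (here refl)     = ⊥-elim (All.lookup x∉ v∈xs refl)
    ... | inj₂ (there v∈ys₂)   = ∈-++⁺ʳ ys₁ v∈ys₂

module _ {a ℓ : Level} {A : Set a} {R : Rel A ℓ} where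

  Linked-++⁻ : ∀ (xs : List A) {y ys} → Linked R (xs ++ y ∷ ys) →
               Linked R (xs ++ [ y ]) × Linked R (y ∷ ys)
  Linked-++⁻ []           l       = [-] , l
  Linked-++⁻ (x ∷ [])     (r ∷ l) = (r ∷ [-]) , l
  Linked-++⁻ (x ∷ x′ ∷ xs) (r ∷ l) with Linked-++⁻ (x′ ∷ xs) l
  ... | l₁ , l₂ = (r ∷ l₁) , l₂

  Linked-++⁺ : ∀ (xs : List A) {y ys} → Linked R (xs ++ [ y ]) → Linked R (y ∷ ys) →
               Linked R (xs ++ y ∷ ys)
  Linked-++⁺ []            _        l = l
  Linked-++⁺ (x ∷ [])      (r ∷ _)  l = r ∷ l
  Linked-++⁺ (x ∷ x′ ∷ xs) (r ∷ l₁) l = r ∷ Linked-++⁺ (x′ ∷ xs) l₁ l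

  Linked-consecutive : ∀ (xs : List A) {y z ys} → Linked R (xs ++ y ∷ z ∷ ys) → R y z
  Linked-consecutive xs l = Linked.head (proj₂ (Linked-++⁻ xs l))

  Linked-insert : ∀ (xs : List A) {y w z ys} → Linked R (xs ++ y ∷ z ∷ ys) →
                  R y w → R w z → Linked R (xs ++ y ∷ w ∷ z ∷ ys)
  Linked-insert xs l ryw rwz with Linked-++⁻ xs l
  ... | l₁ , _ ∷ l₂ = Linked-++⁺ xs l₁ (ryw ∷ rwz ∷ l₂)

  Linked-mono-∈ : ∀ {S : Rel A ℓ} {xs} → (∀ {x y} → x ∈ xs → y ∈ xs → R x y → S x y) →
                  Linked R xs → Linked S xs
  Linked-mono-∈ f []      = []
  Linked-mono-∈ f [-]     = [-]
  Linked-mono-∈ f (r ∷ l) =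
    f (here refl) (there (here refl)) r ∷ Linked-mono-∈ (λ p q → f (there p) (there q)) l

  module _ (R-sym : Symmetric R) where

    Linked-ʳ++ : ∀ {y xs ys} → Linked R (y ∷ xs) → Linked R (y ∷ ys) → Linked R (xs ʳ++ y ∷ ys)
    Linked-ʳ++ [-]      l = l
    Linked-ʳ++ (r ∷ lx) l = Linked-ʳ++ lx (R-sym r ∷ l)

    Linked-reverse-∷ʳ : ∀ (xs : List A) {y} → Linked R (xs ++ [ y ]) → Linked R (y ∷ reverse xs)
    Linked-reverse-∷ʳ []       _ = [-]
    Linked-reverse-∷ʳ (x ∷ xs) {y} l =
      subst (Linked R) (reverse-++ (x ∷ xs) [ y ]) (Linked-ʳ++ l [-])

  -- The index keeps the path before v as one list ys ++ [ u ], the shape in which a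
  -- path ending at v is joined to another one.
  data Predecessor (t v : A) : List A → Set (a ⊔ ℓ) where
    first : ∀ {zs} → R t v → Predecessor t v (v ∷ zs)
    later : ∀ ys {u zs} → R u v → Predecessor t v ((ys ++ [ u ]) ++ v ∷ zs)

  predecessor : ∀ {t v xs} → Linked R (t ∷ xs) → v ∈ xs → Predecessor t v xs
  predecessor (r ∷ _) (here refl) = first r
  predecessor (_ ∷ l) (there v∈xs) with predecessor l v∈xs
  ... | first r    = later [] r
  ... | later ys r = later (_ ∷ ys) r

module _ {n : ℕ} (G : Graph n) where

  open DecMembership (_≟_ {n}) using (_∈?_)

  Adj-sym : Symmetric (Adj G)
  Adj-sym {u} {v} uv = subst (_≡ true) (Graph.sym G u v) uv

  Adj⇒≢ : ∀ {u v} → Adj G u v → u ≢ v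
  Adj⇒≢ {u} uu refl with subst (_≡ true) (irrefl G u) uu
  ... | ()

  neighbours : Fin n → List (Fin n)
  neighbours v = filter (λ w → adj G v w ≟ᵇ true) (allFin n)

  ∈-neighbours⁺ : ∀ {v w} → Adj G v w → w ∈ neighbours v
  ∈-neighbours⁺ {v} vw = ∈-filter⁺ (λ w → adj G v w ≟ᵇ true) (∈-allFin _) vw

  ∈-neighbours⁻ : ∀ {v w} → w ∈ neighbours v → Adj G v w
  ∈-neighbours⁻ {v} w∈ = proj₂ (∈-filter⁻ (λ w → adj G v w ≟ᵇ true) {xs = allFin n} w∈)

  deg≡length-neighbours : ∀ v → deg G v ≡ length (neighbours v)
  deg≡length-neighbours v = count (allFin n)
    where
    count : ∀ ws → sum (map (λ w → if adj G v w then 1 else 0) ws)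
                 ≡ length (filter (λ w → adj G v w ≟ᵇ true) ws)
    count []       = refl
    count (w ∷ ws) with adj G v w
    ... | true  = cong suc (count ws)
    ... | false = count ws

  neighbours-unique : ∀ v → Unique (neighbours v)
  neighbours-unique v = filter⁺ (λ w → adj G v w ≟ᵇ true) (allFin⁺ n)

  deg≤length⇒neighbours⊆ : ∀ {v L} → Unique L → L ⊆ neighbours v → deg G v ≤ length L →
                         neighbours v ⊆ L
  deg≤length⇒neighbours⊆ {v} {L} L-unique L⊆N deg≤ {w} w∈N with w ∈? L
  ... | yes w∈L = w∈L
  ... | no  w∉L = ⊥-elim (1+n≰n (≤-trans longer deg≤))
    where
    longer : suc (length L) ≤ deg G v
    longer = subst (suc (length L) ≤_) (sym (deg≡length-neighbours v))
      (length-mono-⊆ (¬Any⇒All¬ L w∉L ∷ L-unique) λ { (here refl) → w∈N ; (there z∈L) → L⊆N z∈L })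

  deg≡2⇒neighbours⊆pair : ∀ {v x} → deg G v ≡ 2 → Adj G v x →
               Σ[ a ∈ Fin n ] a ≢ x × Adj G v a × neighbours v ⊆ x ∷ a ∷ []
  deg≡2⇒neighbours⊆pair {v} deg≡2 vx
    with length≡2⇒pair (trans (sym (deg≡length-neighbours v)) deg≡2) (neighbours-unique v)
                        (∈-neighbours⁺ vx)
  ... | a , a≢x , a∈N , N⊆ = a , a≢x , ∈-neighbours⁻ a∈N , N⊆

  walk-start : ∀ {P : Fin n → Set} {s t} → WalkIn G P s t → P s
  walk-start (here Ps)     = Ps
  walk-start (step Ps _ _) = Ps

  WalkIn-closed : ∀ {P S : Fin n → Set} {s t} → (∀ {u w} → S u → Adj G u w → P w → S w) →
                  WalkIn G P s t → S s → S t
  WalkIn-closed closed (here _)          Ss = Ss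
  WalkIn-closed closed (step _ sz walk) Ss =
    WalkIn-closed closed walk (closed Ss sz (walk-start walk))

  separated-edge⇒traceable : ∀ {v₁ v₂ x} → TwoConnected G →
    neighbours v₁ ⊆ x ∷ v₂ ∷ [] → neighbours v₂ ⊆ x ∷ v₁ ∷ [] →
    Adj G v₁ v₂ → Adj G v₁ x → Adj G v₂ x → Traceable G
  separated-edge⇒traceable {v₁} {v₂} {x} (_ , _ , avoiding) N₁ N₂ v₁v₂ v₁x v₂x =
    v₁ ∷ v₂ ∷ x ∷ [] , distinct , covers , v₁v₂ ∷ v₂x ∷ [-]
    where
    distinct : Unique (v₁ ∷ v₂ ∷ x ∷ [])
    distinct = (Adj⇒≢ v₁v₂ ∷ Adj⇒≢ v₁x ∷ []) ∷ (Adj⇒≢ v₂x ∷ []) ∷ [] ∷ []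
    closed : ∀ {u w} → u ∈ v₁ ∷ v₂ ∷ [] → Adj G u w → w ≢ x → w ∈ v₁ ∷ v₂ ∷ []
    closed (here refl) uw w≢x with N₁ (∈-neighbours⁺ uw)
    ... | here refl         = ⊥-elim (w≢x refl)
    ... | there (here refl) = there (here refl)
    closed (there (here refl)) uw w≢x with N₂ (∈-neighbours⁺ uw)
    ... | here refl         = ⊥-elim (w≢x refl)
    ... | there (here refl) = here refl
    covers : ∀ w → w ∈ v₁ ∷ v₂ ∷ x ∷ []
    covers w with w ≟ x
    ... | yes refl = there (there (here refl))
    ... | no  w≢x  = ∈-++⁺ˡ (WalkIn-closed closed (avoiding x v₁ w (Adj⇒≢ v₁x) w≢x) (here refl))

  degree-two-pair-nonadjacent : ∀ {v₁ v₂ x a₁ a₂} → TwoConnected G → ¬ Traceable G →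
    Adj G v₁ x → Adj G v₂ x → neighbours v₁ ⊆ x ∷ a₁ ∷ [] → neighbours v₂ ⊆ x ∷ a₂ ∷ [] →
    ¬ Adj G v₁ v₂
  degree-two-pair-nonadjacent 2-connected non-traceable v₁x v₂x N₁ N₂ v₁v₂
    with N₁ (∈-neighbours⁺ v₁v₂) | N₂ (∈-neighbours⁺ (Adj-sym v₁v₂))
  ... | here refl         | _                 = Adj⇒≢ v₂x refl
  ... | there (here refl) | here refl         = Adj⇒≢ v₁x refl
  ... | there (here refl) | there (here refl) =
    non-traceable (separated-edge⇒traceable 2-connected N₁ N₂ v₁v₂ v₁x v₂x)

  Spanning : List (Fin n) → Set
  Spanning L = Unique L × (∀ v → v ∈ L)

  Spanning-resp-↭ : ∀ {L M} → L ↭ M → Spanning L → Spanning M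
  Spanning-resp-↭ L↭M (unique , covers) = Unique-resp-↭ L↭M unique , λ v → ∈-resp-↭ L↭M (covers v)

  traceable-↭ : ∀ {L} T → Spanning L → T ↭ L → Linked (Adj G) T → Traceable G
  traceable-↭ T sp T↭L path with Spanning-resp-↭ (↭-sym T↭L) sp
  ... | unique , covers = T , unique , covers , path

  traceable-by-join : ∀ {s y L M} → Spanning ((s ∷ L) ++ y ∷ M) →
    Linked (Adj G) (s ∷ L) → Adj G s y → Linked (Adj G) (y ∷ M) → Traceable G
  traceable-by-join {s} {y} {L} {M} sp sL sy yM =
    traceable-↭ ((s ∷ L) ʳ++ y ∷ M) sp (↭-sym (++↭ʳ++ (s ∷ L) (y ∷ M)))
      (Linked-ʳ++ Adj-sym sL (sy ∷ yM))

  traceable-by-join-at-end : ∀ {s y L} P → Spanning ((s ∷ L) ++ P ++ [ y ]) →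
    Linked (Adj G) (s ∷ L) → Adj G s y → Linked (Adj G) (P ++ [ y ]) → Traceable G
  traceable-by-join-at-end {s} {y} {L} P sp sL sy Py =
    traceable-by-join (Spanning-resp-↭ (++⁺ˡ (s ∷ L) end-to-front) sp) sL sy
      (Linked-reverse-∷ʳ Adj-sym P Py)
    where
    end-to-front : P ++ [ y ] ↭ y ∷ reverse P
    end-to-front = ↭-sym (↭-trans (∷↭∷ʳ y (reverse P)) (++⁺ʳ [ y ] (↭-reverse P)))

  traceable-by-insertion : ∀ {w y z Q} P → Spanning (w ∷ P ++ y ∷ z ∷ Q) →
    Linked (Adj G) (P ++ y ∷ z ∷ Q) → Adj G y w → Adj G w z → Traceable G
  traceable-by-insertion {w} {y} {z} {Q} P sp path yw wz =
    traceable-↭ (P ++ y ∷ w ∷ z ∷ Q) sp (↭-trans (++⁺ˡ P (swap y w refl)) (shift w P (y ∷ z ∷ Q)))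
      (Linked-insert P path yw wz)

  -- What a hamiltonian path of G + st leaves after deleting the new edge st.
  record SpanningPaths (s t : Fin n) : Set where
    constructor spanningPaths
    field
      left right : List (Fin n)
      spanning   : Spanning ((s ∷ left) ++ t ∷ right)
      left-path  : Linked (Adj G) (s ∷ left)
      right-path : Linked (Adj G) (t ∷ right)

    paths-disjoint : Disjoint (s ∷ left) (t ∷ right)
    paths-disjoint = Unique-++⇒Disjoint (s ∷ left) (proj₁ spanning)

    right-unique : Unique right
    right-unique with Unique-++⁻ʳ (s ∷ left) (proj₁ spanning)
    ... | _ ∷ unique = unique

    start-∉-right : s ∉ right
    start-∉-right s∈R = paths-disjoint (here refl , there s∈R)

    end-∉-right : t ∉ right
    end-∉-right = Unique[x∷xs]⇒x∉xs (Unique-++⁻ʳ (s ∷ left) (proj₁ spanning))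

  SpanningPaths-swap : ∀ {s t} → SpanningPaths s t → SpanningPaths t s
  SpanningPaths-swap {s} {t} (spanningPaths L R sp lp rp) =
    spanningPaths R L (Spanning-resp-↭ (++-comm (s ∷ L) (t ∷ R)) sp) rp lp

  SpanningPaths-on-right : ∀ {s t v} → SpanningPaths s t → v ≢ s → v ≢ t →
    (Σ[ S ∈ SpanningPaths s t ] v ∈ SpanningPaths.right S) ⊎
    (Σ[ S ∈ SpanningPaths t s ] v ∈ SpanningPaths.right S)
  SpanningPaths-on-right {s} {v = v} S v≢s v≢t
    with ∈-++⁻ (s ∷ SpanningPaths.left S) (proj₂ (SpanningPaths.spanning S) v)
  ... | inj₁ (here refl)  = ⊥-elim (v≢s refl)
  ... | inj₁ (there v∈L)  = inj₂ (SpanningPaths-swap S , v∈L)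
  ... | inj₂ (here refl)  = ⊥-elim (v≢t refl)
  ... | inj₂ (there v∈R)  = inj₁ (S , v∈R)

  new-edge-crossing : ∀ {s t L} → Linked (AdjPlus G s t) L →
    Linked (Adj G) L ⊎ ∃₂ λ A B → L ≡ A ++ s ∷ t ∷ B ⊎ L ≡ A ++ t ∷ s ∷ B
  new-edge-crossing []                                = inj₁ []
  new-edge-crossing [-]                               = inj₁ [-]
  new-edge-crossing (inj₂ (inj₁ (refl , refl)) ∷ _) = inj₂ ([] , _ , inj₁ refl)
  new-edge-crossing (inj₂ (inj₂ (refl , refl)) ∷ _) = inj₂ ([] , _ , inj₂ refl)
  new-edge-crossing {L = x ∷ _} (inj₁ xy ∷ l) with new-edge-crossing l
  ... | inj₁ l′                 = inj₁ (xy ∷ l′)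
  ... | inj₂ (A , B , inj₁ eq)  = inj₂ (x ∷ A , B , inj₁ (cong (x ∷_) eq))
  ... | inj₂ (A , B , inj₂ eq)  = inj₂ (x ∷ A , B , inj₂ (cong (x ∷_) eq))

  Linked-AdjPlus-avoiding : ∀ {s t v xs} → v ∈ s ∷ t ∷ [] → v ∉ xs →
    Linked (AdjPlus G s t) xs → Linked (Adj G) xs
  Linked-AdjPlus-avoiding {s} {t} {v} {xs} v∈st v∉xs = Linked-mono-∈ old-edge
    where
    not-both : s ∈ xs → t ∈ xs → ⊥
    not-both s∈xs t∈xs = v∉xs (case v∈st of λ { (here refl) → s∈xs ; (there (here refl)) → t∈xs })
    old-edge : ∀ {a b} → a ∈ xs → b ∈ xs → AdjPlus G s t a b → Adj G a b
    old-edge _    _    (inj₁ ab)                  = ab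
    old-edge a∈xs b∈xs (inj₂ (inj₁ (refl , refl))) = ⊥-elim (not-both a∈xs b∈xs)
    old-edge a∈xs b∈xs (inj₂ (inj₂ (refl , refl))) = ⊥-elim (not-both b∈xs a∈xs)

  SpanningPaths-of-crossing : ∀ {s t u w} A B → u ∈ s ∷ t ∷ [] → w ∈ s ∷ t ∷ [] →
    Spanning (A ++ u ∷ w ∷ B) → Linked (AdjPlus G s t) (A ++ u ∷ w ∷ B) → SpanningPaths u w
  SpanningPaths-of-crossing {u = u} {w} A B u∈st w∈st sp@(unique , _) path
    with Linked-++⁻ A path
  ... | before , _ ∷ after =
    spanningPaths (reverse A) B (Spanning-resp-↭ reorder sp)
      (Linked-reverse-∷ʳ Adj-sym A (Linked-AdjPlus-avoiding w∈st w∉before before))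
      (Linked-AdjPlus-avoiding u∈st u∉after after)
    where
    u∷w∷B-unique : Unique (u ∷ w ∷ B)
    u∷w∷B-unique = Unique-++⁻ʳ A unique
    u∉after : u ∉ w ∷ B
    u∉after = Unique[x∷xs]⇒x∉xs u∷w∷B-unique
    w∉before : w ∉ A ++ [ u ]
    w∉before w∈ with ∈-++⁻ A w∈
    ... | inj₁ w∈A         = Unique-++⇒Disjoint A unique (w∈A , there (here refl))
    ... | inj₂ (here refl) = u∉after (here refl)
    reorder : A ++ u ∷ w ∷ B ↭ (u ∷ reverse A) ++ w ∷ B
    reorder = ↭-trans (++⁺ʳ (u ∷ w ∷ B) (↭-sym (↭-reverse A))) (shift u (reverse A) (w ∷ B))

  SpanningPaths-of-MNT : ∀ {s t} → MaximalNontraceable G → s ≢ t → adj G s t ≡ false →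
    SpanningPaths s t
  SpanningPaths-of-MNT (non-traceable , saturated) s≢t st with saturated _ _ s≢t st
  ... | L , unique , covers , path with new-edge-crossing path
  ...   | inj₁ path′ = ⊥-elim (non-traceable (L , unique , covers , path′))
  ...   | inj₂ (A , B , inj₁ refl) =
    SpanningPaths-of-crossing A B (here refl) (there (here refl)) (unique , covers) path
  ...   | inj₂ (A , B , inj₂ refl) = SpanningPaths-swap
    (SpanningPaths-of-crossing A B (there (here refl)) (here refl) (unique , covers) path)

  SpanningPaths-left-empty : ∀ {s t} (S : SpanningPaths s t) →
    neighbours s ⊆ SpanningPaths.right S → SpanningPaths.left S ≡ []
  SpanningPaths-left-empty (spanningPaths []      _ _ _         _) _ = refl
  SpanningPaths-left-empty S@(spanningPaths (h ∷ _) _ _ (sh ∷ _) _) N⊆R =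
    ⊥-elim (SpanningPaths.paths-disjoint S (there (here refl) , there (N⊆R (∈-neighbours⁺ sh))))

  traceable-if-neighbours-are-ends : ∀ {s t v} (S : SpanningPaths s t) →
    v ∈ SpanningPaths.right S → Adj G s v → neighbours v ⊆ s ∷ t ∷ [] → Traceable G
  traceable-if-neighbours-are-ends {t = t} S@(spanningPaths _ _ sp lp rp) v∈R sv N
    with ∈-∃++ v∈R
  ... | C , []    , refl = traceable-by-join-at-end (t ∷ C) sp lp sv rp
  ... | C , d ∷ D , refl with N (∈-neighbours⁺ (Linked-consecutive (t ∷ C) rp))
  ...   | here refl         = ⊥-elim (SpanningPaths.start-∉-right S (∈-++⁺ʳ C (there (here refl))))
  ...   | there (here refl) = ⊥-elim (SpanningPaths.end-∉-right S (∈-++⁺ʳ C (there (here refl))))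

  degree-two-neighbours-adjacent : ∀ {v p q} → MaximalNontraceable G → p ≢ q →
    Adj G v p → Adj G v q → neighbours v ⊆ p ∷ q ∷ [] → Adj G p q
  degree-two-neighbours-adjacent {v} {p} {q} mnt p≢q vp vq N with adj G p q in pq
  ... | true  = refl
  ... | false with SpanningPaths-on-right (SpanningPaths-of-MNT mnt p≢q pq)
                     (Adj⇒≢ vp) (Adj⇒≢ vq)
  ...   | inj₁ (S , v∈R) =
    ⊥-elim (proj₁ mnt (traceable-if-neighbours-are-ends S v∈R (Adj-sym vp) N))
  ...   | inj₂ (S , v∈R) =
    ⊥-elim (proj₁ mnt (traceable-if-neighbours-are-ends S v∈R (Adj-sym vq)
                         (∈-resp-↭ (swap p q refl) ∘ N)))

  module Rerouting {u₁ u₂ x b₁ b₂ : Fin n}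
    (u₁x : Adj G u₁ x) (u₁b₁ : Adj G u₁ b₁) (u₂b₂ : Adj G u₂ b₂)
    (N-u₁ : neighbours u₁ ⊆ x ∷ b₁ ∷ []) (N-x : neighbours x ⊆ u₁ ∷ u₂ ∷ b₁ ∷ b₂ ∷ [])
    where

    right-neighbour : ∀ {w} (S : SpanningPaths u₁ u₂) → w ∈ SpanningPaths.right S →
                      Adj G x w → w ≡ b₁ ⊎ w ≡ b₂
    right-neighbour S w∈R xw with N-x (∈-neighbours⁺ xw)
    ... | here refl                         = ⊥-elim (SpanningPaths.start-∉-right S w∈R)
    ... | there (here refl)                 = ⊥-elim (SpanningPaths.end-∉-right S w∈R)
    ... | there (there (here refl))         = inj₁ refl
    ... | there (there (there (here refl))) = inj₂ refl

    left-empty : (S : SpanningPaths u₁ u₂) → x ∈ SpanningPaths.right S →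
                 b₁ ∈ SpanningPaths.right S → SpanningPaths.left S ≡ []
    left-empty S x∈R b₁∈R = SpanningPaths-left-empty S λ w∈N → case N-u₁ w∈N of λ where
      (here refl)         → x∈R
      (there (here refl)) → b₁∈R

    traceable : (S : SpanningPaths u₁ u₂) → x ∈ SpanningPaths.right S → Traceable G
    traceable S@(spanningPaths _ _ sp lp rp) x∈R with predecessor rp x∈R
    ... | first {[]} _ = traceable-by-join-at-end (u₂ ∷ []) sp lp u₁x rp
    ... | first {_ ∷ _} u₂x
      with right-neighbour S (there (here refl)) (Linked-consecutive (u₂ ∷ []) rp)
    ...   | inj₁ refl with left-empty S x∈R (there (here refl))
    ...     | refl = traceable-by-insertion (u₂ ∷ []) sp rp (Adj-sym u₁x) u₁b₁
    traceable (spanningPaths L _ sp lp (_ ∷ _ ∷ b₂zs)) _ | first u₂x | inj₂ refl =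
      traceable-by-join (Spanning-resp-↭ (++⁺ˡ (u₁ ∷ L) (swap u₂ x refl)) sp) lp u₁x
        (Adj-sym u₂x ∷ u₂b₂ ∷ b₂zs)
    traceable S@(spanningPaths _ _ sp _ rp) x∈R | later ys {zs = zs} ex
      with right-neighbour S (∈-++⁺ˡ (∈-++⁺ʳ ys (here refl))) (Adj-sym ex)
    ...   | inj₁ refl with left-empty S x∈R (∈-++⁺ˡ (∈-++⁺ʳ ys (here refl)))
    ...     | refl = traceable-by-insertion (u₂ ∷ ys)
                       (subst (λ xs → Spanning (u₁ ∷ u₂ ∷ xs)) (++-assoc ys [ b₁ ] (x ∷ zs)) sp)
                       (subst (λ xs → Linked (Adj G) (u₂ ∷ xs)) (++-assoc ys [ b₁ ] (x ∷ zs)) rp)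
                       (Adj-sym u₁b₁) u₁x
    traceable (spanningPaths _ _ sp lp rp) _ | later ys {zs = []} _ | inj₂ refl =
      traceable-by-join-at-end (u₂ ∷ ys ++ [ b₂ ]) sp lp u₁x rp
    traceable S@(spanningPaths _ _ sp _ rp) x∈R | later ys {zs = _ ∷ _} _ | inj₂ refl
      with right-neighbour S (∈-++⁺ʳ (ys ++ [ b₂ ]) (there (here refl)))
             (Linked-consecutive (u₂ ∷ ys ++ [ b₂ ]) rp)
    ... | inj₁ refl with left-empty S x∈R (∈-++⁺ʳ (ys ++ [ b₂ ]) (there (here refl)))
    ...   | refl = traceable-by-insertion (u₂ ∷ ys ++ [ b₂ ]) sp rp (Adj-sym u₁x) u₁b₁
    traceable S _ | later ys {zs = _ ∷ _} _ | inj₂ refl | inj₂ refl =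
      ⊥-elim (Unique-++⇒Disjoint (ys ++ [ b₂ ]) (SpanningPaths.right-unique S)
                (∈-++⁺ʳ ys (here refl) , there (here refl)))

  four-neighbours⇒traceable : ∀ {v₁ v₂ x a₁ a₂} → MaximalNontraceable G → v₁ ≢ v₂ →
    ¬ Adj G v₁ v₂ → Adj G v₁ x → Adj G v₂ x → Adj G v₁ a₁ → Adj G v₂ a₂ →
    neighbours v₁ ⊆ x ∷ a₁ ∷ [] → neighbours v₂ ⊆ x ∷ a₂ ∷ [] →
    neighbours x ⊆ v₁ ∷ v₂ ∷ a₁ ∷ a₂ ∷ [] → Traceable G
  four-neighbours⇒traceable {v₁} {v₂} {x} {a₁} {a₂}
    mnt v₁≢v₂ ¬v₁v₂ v₁x v₂x v₁a₁ v₂a₂ N-v₁ N-v₂ N-x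
    with SpanningPaths-on-right (SpanningPaths-of-MNT mnt v₁≢v₂ (¬-not ¬v₁v₂))
           (≢-sym (Adj⇒≢ v₁x)) (≢-sym (Adj⇒≢ v₂x))
  ... | inj₁ (S , x∈R) = Rerouting.traceable v₁x v₁a₁ v₂a₂ N-v₁ N-x S x∈R
  ... | inj₂ (S , x∈R) = Rerouting.traceable v₂x v₂a₂ v₁a₁ N-v₂
                           (∈-resp-↭ (swap v₁ v₂ (swap a₁ a₂ refl)) ∘ N-x) S x∈R

lemma3 : ∀ {n} (G : Graph n) → TwoConnected G → MaximalNontraceable G →
    (v₁ v₂ x : Fin n) → deg G v₁ ≡ 2 → deg G v₂ ≡ 2 →
    Adj G v₁ x → Adj G v₂ x →
    (∀ y → Adj G v₁ y → Adj G v₂ y → y ≡ x) →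
    deg G x ≥ 5
lemma3 G 2-connected mnt v₁ v₂ x d₁ d₂ v₁x v₂x common
  with deg≡2⇒neighbours⊆pair G d₁ v₁x | deg≡2⇒neighbours⊆pair G d₂ v₂x | 5 ≤? deg G x
... | _ | _ | yes deg≥5 = deg≥5
... | a₁ , a₁≢x , v₁a₁ , N-v₁ | a₂ , a₂≢x , v₂a₂ , N-v₂ | no deg≱5 =
  ⊥-elim (proj₁ mnt (four-neighbours⇒traceable G mnt v₁≢v₂ ¬v₁v₂ v₁x v₂x v₁a₁ v₂a₂ N-v₁ N-v₂ N-x))
  where
  ¬v₁v₂ : ¬ Adj G v₁ v₂
  ¬v₁v₂ = degree-two-pair-nonadjacent G 2-connected (proj₁ mnt) v₁x v₂x N-v₁ N-v₂
  v₁≢v₂ : v₁ ≢ v₂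
  v₁≢v₂ refl = a₁≢x (common a₁ v₁a₁ v₁a₁)
  a₁≢a₂ : a₁ ≢ a₂
  a₁≢a₂ refl = a₁≢x (common a₁ v₁a₁ v₂a₂)
  distinct : Unique (v₁ ∷ v₂ ∷ a₁ ∷ a₂ ∷ [])
  distinct = (v₁≢v₂ ∷ Adj⇒≢ G v₁a₁ ∷ (λ { refl → ¬v₁v₂ (Adj-sym G v₂a₂) }) ∷ [])
           ∷ ((λ { refl → ¬v₁v₂ v₁a₁ }) ∷ Adj⇒≢ G v₂a₂ ∷ [])
           ∷ (a₁≢a₂ ∷ []) ∷ [] ∷ []
  known-neighbours : v₁ ∷ v₂ ∷ a₁ ∷ a₂ ∷ [] ⊆ neighbours G x
  known-neighbours (here refl)                         = ∈-neighbours⁺ G (Adj-sym G v₁x)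
  known-neighbours (there (here refl))                 = ∈-neighbours⁺ G (Adj-sym G v₂x)
  known-neighbours (there (there (here refl)))         =
    ∈-neighbours⁺ G (degree-two-neighbours-adjacent G mnt (≢-sym a₁≢x) v₁x v₁a₁ N-v₁)
  known-neighbours (there (there (there (here refl)))) =
    ∈-neighbours⁺ G (degree-two-neighbours-adjacent G mnt (≢-sym a₂≢x) v₂x v₂a₂ N-v₂)
  N-x : neighbours G x ⊆ v₁ ∷ v₂ ∷ a₁ ∷ a₂ ∷ []
  N-x = deg≤length⇒neighbours⊆ G distinct known-neighbours (≤-pred (≰⇒> deg≱5))
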